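{- Let $D$ be a digraph. Then there exists a temporization $\lambda: A(D)\to 2^{[2]}\setminus\{\emptyset\}$ (each arc receives a non-empty subset of $\{1,2\}$) such that the temporal digraph $(D,\lambda)$ contains no temporal strong-cycle.
   Context: $D$ is a finite simple digraph (no loops or parallel arcs; opposite arcs allowed). Non-strict model: in a temporal digraph $(D,\lambda)$ a temporal walk is a sequence $(v_1,t_1,v_2,\dots,v_q,t_q,v_{q+1})$ with $q\ge1$, $v_iv_{i+1}\in A(D)$, $t_i\in\lambda(v_iv_{i+1})$, and $t_1\le\dots\le t_q$. A temporal $x,x$-path is such a walk with $v_1=v_{q+1}=x$ and $v_1,\dots,v_q$ distinct; its arc set is $\{v_iv_{i+1}:i\in[q]\}$. A cycle of $D$ is a closed directed path $(v_1,\dots,v_q,v_1)$ with $q\ge2$ and $v_1,\dots,v_q$ distinct. A cycle $C$ of $D$ is a temporal strong-cycle if for every $x\in V(C)$ there is a temporal $x,x$-path whose arc set equals the arc set of $C$. -}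

module Defs where

open import Data.Nat using (ℕ; zero; suc; _≤_)
open import Data.Fin using (Fin; inject₁; fromℕ) renaming (zero to fzero; suc to fsuc)
open import Data.Bool using (Bool; true; false)
open import Data.Product using (Σ; ∃; ∃-syntax; _×_; _,_)
open import Data.Empty using (⊥)
open import Data.Unit using (⊤)
open import Function.Definitions using (Injective)
open import Relation.Binary.PropositionalEquality using (_≡_)
open import Relation.Nullary using (¬_)

-- A finite simple digraph on vertex set Fin n: arcs given by a Boolean
-- adjacency relation (so no parallel arcs), with no loops.
-- Opposite arcs uv and vu are allowed.
record Digraph (n : ℕ) : Set where
  field
    adj    : Fin n → Fin n → Bool
    noLoop : ∀ v → adj v v ≡ false

open Digraph public

Arc : ∀ {n} → Digraph n → Fin n → Fin n → Set
Arc D u v = adj D u v ≡ true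

-- Non-empty subsets of {1,2}.
data Label : Set where
  just1 just2 both : Label

_∈L_ : ℕ → Label → Set
1 ∈L just1 = ⊤
2 ∈L just2 = ⊤
1 ∈L both  = ⊤
2 ∈L both  = ⊤
_ ∈L _     = ⊥

Temporization : ∀ {n} → Digraph n → Set
Temporization {n} D = (u v : Fin n) → Arc D u v → Label

InArcSet : ∀ {n q} → (Fin (suc q) → Fin n) → Fin n → Fin n → Set
InArcSet {q = q} vs u v = ∃[ i ] (vs (inject₁ i) ≡ u × vs (fsuc i) ≡ v)

SameArcSet : ∀ {n q r} → (Fin (suc q) → Fin n) → (Fin (suc r) → Fin n) → Set
SameArcSet {n} vs ws = ∀ (u v : Fin n) →
  (InArcSet vs u v → InArcSet ws u v) × (InArcSet ws u v → InArcSet vs u v)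

record Cycle {n : ℕ} (D : Digraph n) : Set where
  field
    len     : ℕ
    len≥2   : 2 ≤ len
    verts   : Fin (suc len) → Fin n
    closed  : verts (fromℕ len) ≡ verts fzero
    distinct : Injective _≡_ _≡_ (λ (i : Fin len) → verts (inject₁ i))
    arcs    : ∀ (i : Fin len) → Arc D (verts (inject₁ i)) (verts (fsuc i))

record TemporalClosedPath {n : ℕ} (D : Digraph n) (λ' : Temporization D)
                          (x : Fin n) : Set where
  field
    len      : ℕ
    len≥1    : 1 ≤ len
    verts    : Fin (suc len) → Fin n
    times    : Fin len → ℕ
    start    : verts fzero ≡ x
    end      : verts (fromℕ len) ≡ x
    distinct : Injective _≡_ _≡_ (λ (i : Fin len) → verts (inject₁ i))
    arcs     : ∀ (i : Fin len) → Arc D (verts (inject₁ i)) (verts (fsuc i))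
    timeOk   : ∀ (i : Fin len) → times i ∈L λ' _ _ (arcs i)
    monotone : ∀ (i : Fin len) (j : Fin len) → Data.Fin._≤_ i j → times i ≤ times j

IsTemporalStrongCycle : ∀ {n} (D : Digraph n) → Temporization D → Cycle D → Set
IsTemporalStrongCycle {n} D λ' C =
  ∀ (x : Fin n) → (∃[ i ] Cycle.verts C i ≡ x) →
    Σ (TemporalClosedPath D λ' x) λ P →
      SameArcSet (TemporalClosedPath.verts P) (Cycle.verts C)

{-# OPTIONS --safe #-}

-- Label an arc uv with {1} if u < v and with {2} otherwise. Let x be the
-- largest vertex of a cycle. A temporal x,x-path along the cycle leaves x by a
-- descending arc, hence at time 2; by monotonicity every later arc is also
-- taken at time 2 and so descends as well, and a path that only descends
-- cannot return to x.

module Submission where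

open import Defs
open import Data.Nat using (ℕ; zero; suc; z≤n; s≤s) renaming (_≤_ to _≤ℕ_)
open import Data.Nat.Properties using (≮⇒≥) renaming (≤-reflexive to ≤ℕ-reflexive; ≤-trans to ≤ℕ-trans)
open import Data.Fin using (Fin; _≤_; _<_; _<?_; inject₁; fromℕ) renaming (zero to fzero; suc to fsuc)
open import Data.Fin.Properties using (≤-refl; ≤-trans; ≤-total; <-trans; <-asym; <-irrefl; ≤∧≢⇒<)
open import Data.Sum using (inj₁; inj₂)
open import Data.Empty using (⊥)
open import Data.Product using (∃-syntax; Σ; _,_; proj₁)
open import Function using (_∘_)
open import Relation.Nullary using (¬_; yes; no; contradiction)
open import Relation.Binary.PropositionalEquality using (_≡_; _≢_; refl; sym; trans; subst)

private
  variable
    n : ℕ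
    t : ℕ
    u v : Fin n

∈L-just1 : t ∈L just1 → t ≡ 1
∈L-just1 {zero}                ()
∈L-just1 {suc zero}            _ = refl
∈L-just1 {suc (suc zero)}      ()
∈L-just1 {suc (suc (suc _))}   ()

∈L-just2 : t ∈L just2 → t ≡ 2
∈L-just2 {zero}                ()
∈L-just2 {suc zero}            ()
∈L-just2 {suc (suc zero)}      _ = refl
∈L-just2 {suc (suc (suc _))}   ()

orderLabel : Fin n → Fin n → Label
orderLabel u v with u <? v
... | yes _ = just1
... | no  _ = just2

orderTemporization : (D : Digraph n) → Temporization D
orderTemporization D u v _ = orderLabel u v

descending⇒late : v < u → t ∈L orderLabel u v → 2 ≤ℕ t
descending⇒late {v = v} {u = u} v<u t∈ with u <? v
... | yes u<v = contradiction u<v (<-asym v<u)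
... | no  _   = ≤ℕ-reflexive (sym (∈L-just2 t∈))

late⇒descending : t ∈L orderLabel u v → 2 ≤ℕ t → v ≤ u
late⇒descending {u = u} {v = v} t∈ 2≤t with u <? v
... | yes _   = contradiction (subst (2 ≤ℕ_) (∈L-just1 t∈) 2≤t) λ { (s≤s ()) }
... | no  u≮v = ≮⇒≥ u≮v

arc⇒≢ : (D : Digraph n) → Arc D u v → u ≢ v
arc⇒≢ {u = u} D uv refl = contradiction (trans (sym uv) (noLoop D u)) λ ()

maximum-attained : ∀ {m} (f : Fin (suc m) → Fin n) → ∃[ i ] (∀ j → f j ≤ f i)
maximum-attained {m = zero}  f = fzero , λ { fzero → ≤-refl }
maximum-attained {m = suc m} f with maximum-attained (f ∘ fsuc)
... | i , f∘fsuc≤fi with ≤-total (f fzero) (f (fsuc i))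
...   | inj₁ f0≤fi = fsuc i , λ { fzero → f0≤fi ; (fsuc j) → f∘fsuc≤fi j }
...   | inj₂ fi≤f0 = fzero  , λ { fzero → ≤-refl ; (fsuc j) → ≤-trans (f∘fsuc≤fi j) fi≤f0 }

descending⇒last<first : ∀ k (f : Fin (suc (suc k)) → Fin n) →
  (∀ i → f (fsuc i) < f (inject₁ i)) → f (fromℕ (suc k)) < f fzero
descending⇒last<first zero    f desc = desc fzero
descending⇒last<first (suc k) f desc =
  <-trans (desc (fromℕ (suc k))) (descending⇒last<first k (f ∘ inject₁) (desc ∘ inject₁))

InArcSet-bounded : ∀ {q} {b : Fin n} {vs : Fin (suc q) → Fin n} →
  (∀ j → vs j ≤ b) → InArcSet vs u v → v ≤ b
InArcSet-bounded vs≤b (i , _ , refl) = vs≤b (fsuc i)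

module _ {D : Digraph n} {x : Fin n} where
  open TemporalClosedPath

  no-closed-path-from-maximum : (P : TemporalClosedPath D (orderTemporization D) x) →
    (∀ u v → InArcSet (verts P) u v → v ≤ x) → ⊥
  no-closed-path-from-maximum record { len = zero ; len≥1 = () }
  no-closed-path-from-maximum P@record { len = suc k } below =
    <-irrefl (trans (end P) (sym (start P))) (descending⇒last<first k (verts P) every-arc-descends)
    where
    first-arc-descends : verts P (fsuc fzero) < verts P fzero
    first-arc-descends =
      ≤∧≢⇒< (subst (verts P (fsuc fzero) ≤_) (sym (start P)) (below _ _ (fzero , refl , refl)))
            (arc⇒≢ D (arcs P fzero) ∘ sym)
    every-time-late : ∀ i → 2 ≤ℕ times P i
    every-time-late i =
      ≤ℕ-trans (descending⇒late first-arc-descends (timeOk P fzero)) (monotone P fzero i z≤n)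
    every-arc-descends : ∀ i → verts P (fsuc i) < verts P (inject₁ i)
    every-arc-descends i =
      ≤∧≢⇒< (late⇒descending (timeOk P i) (every-time-late i)) (arc⇒≢ D (arcs P i) ∘ sym)

proposition4 : ∀ (n : ℕ) (D : Digraph n) →
    ∃[ λ' ] ¬ (Σ (Cycle D) (IsTemporalStrongCycle D λ'))
proposition4 n D = orderTemporization D , λ (C , strong) →
  let open Cycle C
      (top , maximal) = maximum-attained verts
      (P , sameArcs)  = strong (verts top) (top , refl)
  in no-closed-path-from-maximum P λ u v → InArcSet-bounded maximal ∘ proj₁ (sameArcs u v)
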